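{- Let $p_\phi$ be a program that is safe with respect to a variable typing environment $\Gamma$ and a safe operator typing environment $\Delta$. For every assignment command $x:=e$ occurring in $p_\phi$, $\Gamma(x)\preceq\bigwedge_{y\in\mathcal{V}(e)}\Gamma(y)$, where $\mathcal{V}(e)$ is the set of variables occurring in $e$.
   Context: Programs. Fix a set of variables and a set of operators, each operator $\mathtt{op}$ having an arity $ar(\mathtt{op})\ge0$ and a total function $[\![\mathtt{op}]\!]$ on words. With a single oracle symbol $\phi$: expressions $e::=x\mid \mathtt{op}(e_1,\dots,e_{ar(\mathtt{op})})\mid \phi(e_1\upharpoonright e_2)$; commands $c::=\mathtt{skip}\mid x:=e\mid c_1;c_2\mid \mathtt{if}(e)\{c_1\}\,\mathtt{else}\,\{c_0\}\mid \mathtt{while}(e)\{c\}$; programs $p_\phi::=c\ \mathtt{return}\ x$. Operators. For words, $v\unlhd w$ means $v$ is a contiguous subword of $w$. $\mathtt{op}$ is neutral if $ar(\mathtt{op})=0$, or $[\![\mathtt{op}]\!]$ takes values in $\{0,1\}$, or for all $\bar w$ there is $i$ with $[\![\mathtt{op}]\!](\bar w)\unlhd w_i$. $\mathtt{op}$ is positive if there is a constant $c$ with $|[\![\mathtt{op}]\!](\bar w)|\le\max_i|w_i|+c$ for all $\bar w$. Typing. Tiers are natural numbers $\mathbf 0,\mathbf 1,\dots$ with the usual order $\preceq$ (strict: $\prec$), $\vee=\max$, $\wedge=\min$. A variable typing environment $\Gamma$ maps variables to tiers; an operator typing environment $\Delta$ assigns to each operator $\mathtt{op}$ and tier $t$ a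 set $\Delta(\mathtt{op})(t)$ of types $t_1\to\dots\to t_{ar(\mathtt{op})}\to t'$. Judgments $\Gamma,\Delta\vdash b:(t,t_{in},t_{out})$ are derived by the rules (writing $\vdash$ for $\Gamma,\Delta\vdash$, all tiers arbitrary): (V) $\vdash x:(\Gamma(x),t_{in},t_{out})$; (OP) if $t_1\to\dots\to t_n\to t\in\Delta(\mathtt{op})(t_{in})$ and $\vdash e_i:(t_i,t_{in},t_{out})$ for all $i\le n=ar(\mathtt{op})$ then $\vdash\mathtt{op}(e_1,\dots,e_n):(t,t_{in},t_{out})$; (OR) if $\vdash e_1:(t,t_{in},t_{out})$, $\vdash e_2:(t_{out},t_{in},t_{out})$, $t\prec t_{in}$ and $t\preceq t_{out}$ then $\vdash\phi(e_1\upharpoonright e_2):(t,t_{in},t_{out})$; (SUB) for a command $c$, if $\vdash c:(t,t_{in},t_{out})$ then $\vdash c:(t+1,t_{in},t_{out})$; (SK) $\vdash\mathtt{skip}:(\mathbf0,t_{in},t_{out})$; (A) if $\vdash x:(t_1,t_{in},t_{out})$, $\vdash e:(t_2,t_{in},t_{out})$, $t_1\preceq t_2$ then $\vdash x:=e:(t_1,t_{in},t_{out})$; (S) if $\vdash c_1:\tau$ and $\vdash c_2:\tau$ then $\vdash c_1;c_2:\tau$; (C) if $\vdash e:\tau$, $\vdash c_1:\tau$, $\vdash c_0:\tau$ then $\vdash\mathtt{if}(e)\{c_1\}\mathtt{else}\{c_0\}:\tau$; (W) if $\vdash e:(t,t_{in},t_{out})$, $\vdash c:(t,t,t_{out})$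 and $\mathbf1\preceq t\preceq t_{out}$ then $\vdash\mathtt{while}(e)\{c\}:(t,t_{in},t_{out})$; (W$_0$) if $\vdash e:(t,t_{in},t)$, $\vdash c:(t,t,t)$ and $\mathbf1\preceq t$ then $\vdash\mathtt{while}(e)\{c\}:(t,t_{in},\mathbf0)$. Safety. $\Delta$ is safe if for each operator $\mathtt{op}$ it types with $ar(\mathtt{op})>0$: $\mathtt{op}$ is neutral or positive, $[\![\mathtt{op}]\!]$ is polynomial-time computable, and for every tier $t_{in}$ and every $t_1\to\dots\to t_n\to t\in\Delta(\mathtt{op})(t_{in})$: $t\preceq\wedge_i t_i\preceq\vee_i t_i\preceq t_{in}$, and $t\prec t_{in}$ if $\mathtt{op}$ is positive but not neutral. A program $c\ \mathtt{return}\ x$ is safe with respect to $\Gamma,\Delta$ if $\Delta$ is safe and $\Gamma,\Delta\vdash c:(t,t_{in},t_{out})$ for some tiers. -}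

module Defs where

open import Data.Nat using (ℕ; zero; suc; _≤_; _<_; _⊔_; _+_)
open import Data.Bool using (Bool; true; false)
open import Data.List using (List; []; _∷_; _++_; length)
open import Data.Vec using (Vec; []; _∷_; lookup; foldr′; map)
open import Data.Fin using (Fin)
open import Data.Product using (Σ; ∃; _×_; _,_)
open import Data.Sum using (_⊎_)
open import Relation.Binary.PropositionalEquality using (_≡_)
open import Relation.Nullary using (¬_)

Word : Set
Word = List Bool

_⊴_ : Word → Word → Set
v ⊴ w = Σ Word λ u → Σ Word λ u′ → w ≡ u ++ v ++ u′

Tier : Set
Tier = ℕ

maxLen : ∀ {n} → Vec Word n → ℕ
maxLen ws = foldr′ (λ w m → length w ⊔ m) 0 ws

module Lang (Var : Set) (Op : Set) (ar : Op → ℕ)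
            (sem : (o : Op) → Vec Word (ar o) → Word) where

  -- expressions  e ::= x | op(e1,…,en) | ϕ(e1 ↾ e2)
  data Exp : Set where
    var  : Var → Exp
    op   : (o : Op) → Vec Exp (ar o) → Exp
    orc  : Exp → Exp → Exp

  data Cmd : Set where
    skip   : Cmd
    _≔_    : Var → Exp → Cmd
    _︔_    : Cmd → Cmd → Cmd
    if_then_else_ : Exp → Cmd → Cmd → Cmd
    while_loop_ : Exp → Cmd → Cmd

  record Prog : Set where
    constructor _return_
    field
      body : Cmd
      ret  : Var

  mutual
    data _∈V_ (y : Var) : Exp → Set where
      here  : y ∈V var y
      inop  : ∀ {o es} → y ∈Vs es → y ∈V op o es
      inor₁ : ∀ {e₁ e₂} → y ∈V e₁ → y ∈V orc e₁ e₂
      inor₂ : ∀ {e₁ e₂} → y ∈V e₂ → y ∈V orc e₁ e₂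

    data _∈Vs_ (y : Var) : ∀ {n} → Vec Exp n → Set where
      hd : ∀ {n e} {es : Vec Exp n} → y ∈V e → y ∈Vs (e ∷ es)
      tl : ∀ {n e} {es : Vec Exp n} → y ∈Vs es → y ∈Vs (e ∷ es)

  data AssignIn (x : Var) (e : Exp) : Cmd → Set where
    this  : AssignIn x e (x ≔ e)
    seq₁  : ∀ {c₁ c₂} → AssignIn x e c₁ → AssignIn x e (c₁ ︔ c₂)
    seq₂  : ∀ {c₁ c₂} → AssignIn x e c₂ → AssignIn x e (c₁ ︔ c₂)
    if₀   : ∀ {b c₁ c₀} → AssignIn x e c₁ → AssignIn x e (if b then c₁ else c₀)
    if₁   : ∀ {b c₁ c₀} → AssignIn x e c₀ → AssignIn x e (if b then c₁ else c₀)
    body  : ∀ {b c} → AssignIn x e c → AssignIn x e (while b loop c)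

  AssignInProg : Var → Exp → Prog → Set
  AssignInProg x e p = AssignIn x e (Prog.body p)

  VarEnv : Set
  VarEnv = Var → Tier

  -- operator typing environments: Δ o tin ts t  means
  -- (t₁ → … → tₙ → t) ∈ Δ(o)(tin), with ts = (t₁,…,tₙ).
  OpEnv : Set₁
  OpEnv = (o : Op) → Tier → Vec Tier (ar o) → Tier → Set

  Neutral : Op → Set
  Neutral o = (ar o ≡ 0)
            ⊎ (∀ ws → (sem o ws ≡ false ∷ []) ⊎ (sem o ws ≡ true ∷ []))
            ⊎ (∀ ws → Σ (Fin (ar o)) λ i → sem o ws ⊴ lookup ws i)

  Positive : Op → Set
  Positive o = Σ ℕ λ c → ∀ ws → length (sem o ws) ≤ maxLen ws + c

  module Typing (Γ : VarEnv) (Δ : OpEnv) where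
    mutual
      data ⊢e_∶_,_,_ : Exp → Tier → Tier → Tier → Set where
        V  : ∀ {x tin tout} → ⊢e var x ∶ Γ x , tin , tout
        OP : ∀ {o es ts t tin tout} → Δ o tin ts t →
             ⊢es es ∶ ts , tin , tout → ⊢e op o es ∶ t , tin , tout
        OR : ∀ {e₁ e₂ t tin tout} →
             ⊢e e₁ ∶ t , tin , tout → ⊢e e₂ ∶ tout , tin , tout →
             t < tin → t ≤ tout → ⊢e orc e₁ e₂ ∶ t , tin , tout

      data ⊢es_∶_,_,_ : ∀ {n} → Vec Exp n → Vec Tier n → Tier → Tier → Set where
        []  : ∀ {tin tout} → ⊢es [] ∶ [] , tin , tout
        _∷_ : ∀ {n e t tin tout} {es : Vec Exp n} {ts} →
              ⊢e e ∶ t , tin , tout → ⊢es es ∶ ts , tin , tout →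
              ⊢es e ∷ es ∶ t ∷ ts , tin , tout

    data ⊢c_∶_,_,_ : Cmd → Tier → Tier → Tier → Set where
      SUB : ∀ {c t tin tout} → ⊢c c ∶ t , tin , tout → ⊢c c ∶ suc t , tin , tout
      SK  : ∀ {tin tout} → ⊢c skip ∶ 0 , tin , tout
      A   : ∀ {x e t₁ t₂ tin tout} → ⊢e var x ∶ t₁ , tin , tout →
            ⊢e e ∶ t₂ , tin , tout → t₁ ≤ t₂ → ⊢c x ≔ e ∶ t₁ , tin , tout
      S   : ∀ {c₁ c₂ t tin tout} → ⊢c c₁ ∶ t , tin , tout → ⊢c c₂ ∶ t , tin , tout →
            ⊢c c₁ ︔ c₂ ∶ t , tin , tout
      C   : ∀ {e c₁ c₀ t tin tout} → ⊢e e ∶ t , tin , tout →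
            ⊢c c₁ ∶ t , tin , tout → ⊢c c₀ ∶ t , tin , tout →
            ⊢c if e then c₁ else c₀ ∶ t , tin , tout
      W   : ∀ {e c t tin tout} → ⊢e e ∶ t , tin , tout → ⊢c c ∶ t , t , tout →
            1 ≤ t → t ≤ tout → ⊢c while e loop c ∶ t , tin , tout
      W₀  : ∀ {e c t tin} → ⊢e e ∶ t , tin , t → ⊢c c ∶ t , t , t →
            1 ≤ t → ⊢c while e loop c ∶ t , tin , 0

  -- Safety of an operator typing environment, relative to a predicate PT
  -- expressing "is polynomial-time computable".
  SafeOpEnv : (PT : (o : Op) → (Vec Word (ar o) → Word) → Set) → OpEnv → Set
  SafeOpEnv PT Δ =
    ∀ (o : Op) → 0 < ar o →
      (Σ Tier λ tin → Σ (Vec Tier (ar o)) λ ts → Σ Tier λ t → Δ o tin ts t) →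
        (Neutral o ⊎ Positive o)
      × PT o (sem o)
      × (∀ tin ts t → Δ o tin ts t →
            (∀ i → t ≤ lookup ts i)
          × (∀ i → lookup ts i ≤ tin)         -- ⋁ᵢ tᵢ ⪯ tin  (⋀ ⪯ ⋁ automatic, n > 0)
          × (Positive o → ¬ Neutral o → t < tin))

  SafeProg : (PT : (o : Op) → (Vec Word (ar o) → Word) → Set) →
             VarEnv → OpEnv → Prog → Set
  SafeProg PT Γ Δ p =
    SafeOpEnv PT Δ × (Σ Tier λ t → Σ Tier λ tin → Σ Tier λ tout →
                        Typing.⊢c_∶_,_,_ Γ Δ (Prog.body p) t tin tout)

-- Each expression typing rule can only lower tiers on the way from a variable
-- to the whole expression: a safe operator's result tier lies below all of its
-- argument tiers, and an oracle call ϕ(e₁ ↾ e₂) has a tier below both that of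
-- e₁ and t_out, the tier of e₂. Hence a well-typed expression has a tier below
-- that of every variable occurring in it, and rule (A) puts Γ(x) below the tier
-- of e; the command rules merely pass their typing on to the subcommands.
module Submission where

open import Defs
open import Data.Nat using (ℕ; _≤_; >-nonZero⁻¹)
open import Data.Nat.Properties using (≤-refl; ≤-trans)
open import Data.Vec using (Vec; _∷_; lookup)
open import Data.Fin using (Fin; zero; suc)
open import Data.Fin.Properties using (nonZeroIndex)
open import Data.Product using (Σ; _,_; proj₁; proj₂)

module TierMonotonicity (Var Op : Set) (ar : Op → ℕ)
                        (sem : (o : Op) → Vec Word (ar o) → Word) where
  open Lang Var Op ar sem

  TierDecreasing : OpEnv → Set
  TierDecreasing Δ = ∀ o tin ts t → Δ o tin ts t → ∀ i → t ≤ lookup ts i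

  safe⇒tierDecreasing : ∀ PT {Δ} → SafeOpEnv PT Δ → TierDecreasing Δ
  safe⇒tierDecreasing _ safe o tin ts t δ i =
    proj₁ (proj₂ (proj₂ (safe o arity>0 (tin , ts , t , δ))) tin ts t δ) i
    where arity>0 = >-nonZero⁻¹ (ar o) {{nonZeroIndex i}}

  module _ (Γ : VarEnv) (Δ : OpEnv) (decreasing : TierDecreasing Δ) where
    open Typing Γ Δ

    mutual
      ⊢e-tier≤var : ∀ {e t tin tout y} →
                    ⊢e e ∶ t , tin , tout → y ∈V e → t ≤ Γ y
      ⊢e-tier≤var V here = ≤-refl
      ⊢e-tier≤var (OP {ts = ts} {t = t} {tin = tin} δ ⊢es) (inop y∈es)
        with i , tᵢ≤Γy ← ⊢es-someTier≤var ⊢es y∈es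
        = ≤-trans (decreasing _ tin ts t δ i) tᵢ≤Γy
      ⊢e-tier≤var (OR ⊢e₁ _ _ _) (inor₁ y∈e₁) = ⊢e-tier≤var ⊢e₁ y∈e₁
      ⊢e-tier≤var (OR _ ⊢e₂ _ t≤tout) (inor₂ y∈e₂) =
        ≤-trans t≤tout (⊢e-tier≤var ⊢e₂ y∈e₂)

      ⊢es-someTier≤var : ∀ {n} {es : Vec Exp n} {ts tin tout y} →
                         ⊢es es ∶ ts , tin , tout → y ∈Vs es →
                         Σ (Fin n) λ i → lookup ts i ≤ Γ y
      ⊢es-someTier≤var (⊢e ∷ _) (hd y∈e) = zero , ⊢e-tier≤var ⊢e y∈e
      ⊢es-someTier≤var (_ ∷ ⊢es) (tl y∈es)
        with i , tᵢ≤Γy ← ⊢es-someTier≤var ⊢es y∈es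
        = suc i , tᵢ≤Γy

    ⊢c-assigned≤var : ∀ {c t tin tout x e y} →
                      ⊢c c ∶ t , tin , tout → AssignIn x e c → y ∈V e → Γ x ≤ Γ y
    ⊢c-assigned≤var (SUB ⊢c) x≔e y∈e = ⊢c-assigned≤var ⊢c x≔e y∈e
    ⊢c-assigned≤var (A V ⊢e Γx≤t) this y∈e = ≤-trans Γx≤t (⊢e-tier≤var ⊢e y∈e)
    ⊢c-assigned≤var (S ⊢c₁ _) (seq₁ x≔e) y∈e = ⊢c-assigned≤var ⊢c₁ x≔e y∈e
    ⊢c-assigned≤var (S _ ⊢c₂) (seq₂ x≔e) y∈e = ⊢c-assigned≤var ⊢c₂ x≔e y∈e
    ⊢c-assigned≤var (C _ ⊢c₁ _) (if₀ x≔e) y∈e = ⊢c-assigned≤var ⊢c₁ x≔e y∈e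
    ⊢c-assigned≤var (C _ _ ⊢c₀) (if₁ x≔e) y∈e = ⊢c-assigned≤var ⊢c₀ x≔e y∈e
    ⊢c-assigned≤var (W _ ⊢c _ _) (body x≔e) y∈e = ⊢c-assigned≤var ⊢c x≔e y∈e
    ⊢c-assigned≤var (W₀ _ ⊢c _) (body x≔e) y∈e = ⊢c-assigned≤var ⊢c x≔e y∈e

corollary6p2 : (Var Op : Set) (ar : Op → ℕ) (sem : (o : Op) → Vec Word (ar o) → Word)
    (PT : (o : Op) → (Vec Word (ar o) → Word) → Set) →
    let open Lang Var Op ar sem in
    (Γ : VarEnv) (Δ : OpEnv) (p : Prog) → SafeProg PT Γ Δ p →
    ∀ (x : Var) (e : Exp) → AssignInProg x e p →
    ∀ (y : Var) → y ∈V e → Γ x ≤ Γ y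
corollary6p2 Var Op ar sem PT Γ Δ p (safeΔ , _ , _ , _ , ⊢p) x e x≔e y y∈e =
  ⊢c-assigned≤var Γ Δ (safe⇒tierDecreasing PT safeΔ) ⊢p x≔e y∈e
  where open TierMonotonicity Var Op ar sem
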